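{- Let $\bar x$ be a tuple of field-sort variables, $\bar y$ a tuple of vector-sort variables, and $t(\bar x,\bar y)$ an $\mathcal{L}_{K,V,c}$-term. (1) If $t$ is valued in the vector sort, then $t(\bar x,\bar y)=\sum_{i=1}^n t_i(\bar x,\bar y)\cdot m_i(\bar y)$ (in every model of $T_0$) for some field-valued terms $t_i(\bar x,\bar y)$ and Lie monomials $m_i(\bar y)$ in the variables $\bar y$. (2) If $t$ is valued in the field sort, then $t(\bar x,\bar y)=s(\bar x,\bar m(\bar y))$ (in every model of $T_0$) for some $\mathcal{L}^-_{K,V,c}$-term $s$ and some tuple $\bar m(\bar y)$ of Lie monomials in the variables $\bar y$.
   Context: Fix $c\ge1$. A Lazard series of a Lie algebra $L$ is a chain of subalgebras $L=L_1\supseteq\dots\supseteq L_{c+1}=0$ with $[L_i,L_j]\subseteq L_{i+j}$ ($L_k=0$ for $k>c$). The two-sorted language $\mathcal{L}_{K,V,c}$ has a field sort $K$ with the ring language $0,1,+,-,\times$; a vector sort $V$ with $0_V$, binary functions $+,-,[\cdot,\cdot]:V^2\to V$, unary predicates $P_1,\dots,P_{c+1}$ and $n$-ary relations $\theta_n$ ($n\ge1$); a function $\cdot:K\times V\to V$; and functions $\pi_{n,i}:V^{n+1}\to K$ ($1\le i\le n$). $\mathcal{L}^-_{K,V,c}$ is $\mathcal{L}_{K,V,c}$ without the symbol $[\cdot,\cdot]$. $T_0$ states: $K$ is a field; $V$ is a $K$-vector space under $\cdot$; $[\cdot,\cdot]$ is alternating, $K$-bilinear and satisfies Jacobi; $(P_i(V))_i$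 is a Lazard series of $K$-subspaces; $\theta_n(\bar v)$ iff $\bar v$ is linearly independent; $\pi_{n,i}(v_1,\dots,v_n,w)=\alpha_i$ if the $v_j$ are linearly independent and $w=\sum_j\alpha_jv_j$, and $0$ otherwise. A Lie monomial in $\bar y$ is a term built from variables of $\bar y$ using only the bracket $[\cdot,\cdot]$. -}

module Defs where

open import Level using (Level; _⊔_) renaming (suc to lsuc; zero to lzero)
open import Data.Nat using (ℕ; zero; suc; _+_; _<_; _<?_)
open import Data.Fin using (Fin; fromℕ; fromℕ<; toℕ; inject₁)
import Data.Fin as F
open import Data.Vec using (Vec; []; _∷_; lookup)
open import Data.Product using (Σ; ∃; _×_; _,_)
open import Data.Unit using (⊤)
open import Data.Empty using (⊥)
open import Relation.Nullary using (¬_; yes; no)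
open import Relation.Binary.PropositionalEquality using (_≡_; _≢_)
open import Algebra.Structures using (IsCommutativeRing; IsAbelianGroup)

-- Syntax of the two-sorted language L_{K,V,c}
-- (terms do not depend on c: the P_i and θ_n are relation symbols)

data Sort : Set where
  κ ν : Sort

-- The bracket constructor requires an
-- element of Br: Br = ⊤ gives L_{K,V,c}, Br = ⊥ gives L^-_{K,V,c}.
data Term (Br : Set) (m k : ℕ) : Sort → Set where
  fvar  : Fin m → Term Br m k κ
  vvar  : Fin k → Term Br m k ν
  t0K t1K : Term Br m k κ
  _t+K_ _t-K_ _t×K_ : Term Br m k κ → Term Br m k κ → Term Br m k κ
  t0V   : Term Br m k ν
  _t+V_ _t-V_ : Term Br m k ν → Term Br m k ν → Term Br m k ν
  brk   : Br → Term Br m k ν → Term Br m k ν → Term Br m k ν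
  _t·_  : Term Br m k κ → Term Br m k ν → Term Br m k ν
  -- π n i args w  is  π_{n,i+1}(v_1,…,v_n,w)
  π     : (n : ℕ) → Fin n → Vec (Term Br m k ν) n → Term Br m k ν → Term Br m k κ

Full : Set
Full = ⊤

Minus : Set
Minus = ⊥

data LieMon (k : ℕ) : Set where
  var : Fin k → LieMon k
  br  : LieMon k → LieMon k → LieMon k

module _ {a : Level} {K V : Set a} (0K : K) (0V : V)
         (_+V_ : V → V → V) (_•_ : K → V → V) where

  lincomb : {n : ℕ} → Vec K n → Vec V n → V
  lincomb []      []       = 0V
  lincomb (α ∷ αs) (v ∷ vs) = (α • v) +V lincomb αs vs

  LinIndep : {n : ℕ} → Vec V n → Set a
  LinIndep {n} vs = (αs : Vec K n) → lincomb αs vs ≡ 0V → (j : Fin n) → lookup αs j ≡ 0K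

  InSpan : {n : ℕ} → Vec V n → V → Set a
  InSpan {n} vs w = Σ (Vec K n) λ αs → w ≡ lincomb αs vs

-- Lazard-series index: given P : Fin (suc c) → V → Set, with P i standing
-- for P_{i+1}, LL (suc n) is L_{n+1} for n ≤ c and the zero subspace for
-- n > c (i.e. L_k = 0 for k > c+1; L_{c+1} = P_{c+1} = 0 by the axioms).
LL : {a : Level} {V : Set a} (c : ℕ) (0V : V) (P : Fin (suc c) → V → Set a) → ℕ → V → Set a
LL c 0V P zero    v = v ≡ 0V   -- never used
LL c 0V P (suc n) v with n <? suc c
... | yes p = P (fromℕ< p) v
... | no  _ = v ≡ 0V

record Model (c : ℕ) (a : Level) : Set (lsuc a) where
  infixl 6 _+K_ _-K_ _+V_ _-V_
  infixl 7 _*K_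
  infixr 7 _•_
  field
    K V : Set a
    0K 1K : K
    _+K_ _-K_ _*K_ : K → K → K
    0V : V
    _+V_ _-V_ : V → V → V
    ⟦_,_⟧ : V → V → V
    _•_ : K → V → V
    -- P i stands for P_{i+1}, i.e. P_1, …, P_{c+1}
    P : Fin (suc c) → V → Set a
    -- θ n stands for θ_{n+1}  (n-ary relations for n ≥ 1)
    θ : (n : ℕ) → Vec V (suc n) → Set a
    -- πf n i vs w is π_{n,i+1}(vs, w)
    πf : (n : ℕ) → Fin n → Vec V n → V → K

    K-comm-ring : IsCommutativeRing _≡_ _+K_ _*K_ (λ x → 0K -K x) 0K 1K
    K-minus : ∀ x y → x -K y ≡ x +K (0K -K y)
    K-nontrivial : 0K ≢ 1K
    K-inverse : ∀ x → x ≢ 0K → Σ K λ y → x *K y ≡ 1K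

    V-abgroup : IsAbelianGroup _≡_ _+V_ 0V (λ v → 0V -V v)
    V-minus : ∀ v w → v -V w ≡ v +V (0V -V w)
    •-distrib-V : ∀ α v w → α • (v +V w) ≡ α • v +V α • w
    •-distrib-K : ∀ α β v → (α +K β) • v ≡ α • v +V β • v
    •-assoc : ∀ α β v → (α *K β) • v ≡ α • (β • v)
    •-one : ∀ v → 1K • v ≡ v

    br-alt : ∀ v → ⟦ v , v ⟧ ≡ 0V
    br-add-l : ∀ u v w → ⟦ u +V v , w ⟧ ≡ ⟦ u , w ⟧ +V ⟦ v , w ⟧
    br-add-r : ∀ u v w → ⟦ u , v +V w ⟧ ≡ ⟦ u , v ⟧ +V ⟦ u , w ⟧
    br-smul-l : ∀ α v w → ⟦ α • v , w ⟧ ≡ α • ⟦ v , w ⟧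
    br-smul-r : ∀ α v w → ⟦ v , α • w ⟧ ≡ α • ⟦ v , w ⟧
    br-jacobi : ∀ u v w → ⟦ u , ⟦ v , w ⟧ ⟧ +V ⟦ v , ⟦ w , u ⟧ ⟧ +V ⟦ w , ⟦ u , v ⟧ ⟧ ≡ 0V

    P-zero : ∀ i → P i 0V
    P-add : ∀ i v w → P i v → P i w → P i (v +V w)
    P-smul : ∀ i α v → P i v → P i (α • v)
    P-first : ∀ v → P F.zero v
    P-last : ∀ v → P (fromℕ c) v → v ≡ 0V
    P-decr : ∀ (i : Fin c) v → P (F.suc i) v → P (inject₁ i) v
    P-lazard : ∀ i j v w → P i v → P j w →
               LL c 0V P (suc (toℕ i) + suc (toℕ j)) ⟦ v , w ⟧

    θ-def₁ : ∀ n vs → θ n vs → LinIndep 0K 0V _+V_ _•_ vs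
    θ-def₂ : ∀ n vs → LinIndep 0K 0V _+V_ _•_ vs → θ n vs

    π-coord : ∀ n i vs αs → LinIndep 0K 0V _+V_ _•_ {n} vs →
              πf n i vs (lincomb 0K 0V _+V_ _•_ αs vs) ≡ lookup αs i
    π-other : ∀ n i vs w →
              ¬ (LinIndep 0K 0V _+V_ _•_ {n} vs × InSpan 0K 0V _+V_ _•_ vs w) →
              πf n i vs w ≡ 0K

module Sem {c : ℕ} {a : Level} (M : Model c a) where
  open Model M

  Dom : Sort → Set a
  Dom κ = K
  Dom ν = V

  vsum : {n : ℕ} → (Fin n → V) → V
  vsum {zero}  f = 0V
  vsum {suc n} f = f F.zero +V vsum (λ i → f (F.suc i))

  evalMon : {k : ℕ} → LieMon k → (Fin k → V) → V
  evalMon (var j)  y = y j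
  evalMon (br u w) y = ⟦ evalMon u y , evalMon w y ⟧

  mutual
    eval : {Br : Set} {m k : ℕ} {s : Sort} → Term Br m k s → (Fin m → K) → (Fin k → V) → Dom s
    eval (fvar i)    x y = x i
    eval (vvar j)    x y = y j
    eval t0K         x y = 0K
    eval t1K         x y = 1K
    eval (t t+K u)    x y = eval t x y +K eval u x y
    eval (t t-K u)    x y = eval t x y -K eval u x y
    eval (t t×K u)    x y = eval t x y *K eval u x y
    eval t0V         x y = 0V
    eval (t t+V u)    x y = eval t x y +V eval u x y
    eval (t t-V u)    x y = eval t x y -V eval u x y
    eval (brk _ t u) x y = ⟦ eval t x y , eval u x y ⟧
    eval (t t· u)     x y = eval t x y • eval u x y
    eval (π n i ts w) x y = πf n i (evalVec ts x y) (eval w x y)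

    evalVec : {Br : Set} {m k n : ℕ} → Vec (Term Br m k ν) n → (Fin m → K) → (Fin k → V) → Vec V n
    evalVec []       x y = []
    evalVec (t ∷ ts) x y = eval t x y ∷ evalVec ts x y

{-# OPTIONS --safe #-}
-- Bilinearity of the bracket pushes every bracket down to the variables, so a
-- vector term computes symbolically to a formal linear combination Σ cᵢ · mᵢ of
-- Lie monomials whose coefficients are built from the field subterms by ring
-- operations.  Normalising the vector arguments of every π in a field term this
-- way, the vectors the term still mentions are Lie monomials, and turning the
-- finitely many occurring monomials into fresh vector variables removes the
-- bracket.
module Submission where

open import Defs
open import Level using (Level)
open import Data.Nat using (ℕ)
open import Data.Fin using (Fin)
open import Data.Product using (Σ; _×_; _,_; proj₁; proj₂; map₁)
open import Data.Vec using (Vec; []; _∷_)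
open import Data.List using (List; []; _∷_; _++_; [_]; length; lookup; map; cartesianProductWith)
open import Data.List.Relation.Binary.Subset.Propositional using (_⊆_)
open import Data.List.Relation.Binary.Subset.Propositional.Properties using (⊆-refl; ⊆-trans; xs⊆xs++ys; xs⊆ys++xs)
open import Data.List.Membership.Propositional using (_∈_)
open import Data.List.Relation.Unary.Any using (here; there; index)
open import Data.List.Relation.Unary.Any.Properties using (lookup-index)
open import Data.Unit using (tt)
open import Function using (_∘_)
open import Algebra.Bundles using (AbelianGroup)
open import Algebra.Structures using (IsCommutativeRing; IsAbelianGroup)
import Algebra.Properties.Group as GroupProperties
import Algebra.Properties.AbelianGroup as AbelianGroupProperties
open import Relation.Binary.PropositionalEquality using (_≡_; refl; sym; trans; cong; cong₂; module ≡-Reasoning)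

⊆-++⁻ˡ : {A : Set} (xs : List A) {ys zs : List A} → xs ++ ys ⊆ zs → xs ⊆ zs
⊆-++⁻ˡ xs {ys} xs++ys⊆zs = ⊆-trans (xs⊆xs++ys xs ys) xs++ys⊆zs

⊆-++⁻ʳ : {A : Set} (xs : List A) {ys zs : List A} → xs ++ ys ⊆ zs → ys ⊆ zs
⊆-++⁻ʳ xs {ys} xs++ys⊆zs = ⊆-trans (xs⊆ys++xs ys xs) xs++ys⊆zs

module ModelProperties {c : ℕ} {a : Level} (M : Model c a) where
  open Model M

  private
    V-abelianGroup : AbelianGroup a a
    V-abelianGroup = record { isAbelianGroup = V-abgroup }
    module V-abelian = AbelianGroupProperties V-abelianGroup
    module V-group = GroupProperties (AbelianGroup.group V-abelianGroup)
    module K = IsCommutativeRing K-comm-ring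
    module V-structure = IsAbelianGroup V-abgroup

  •-zeroˡ : ∀ v → 0K • v ≡ 0V
  •-zeroˡ v = V-group.identityʳ-unique (0K • v) (0K • v)
    (trans (sym (•-distrib-K 0K 0K v)) (cong (_• v) (K.+-identityˡ 0K)))

  •-zeroʳ : ∀ α → α • 0V ≡ 0V
  •-zeroʳ α = V-group.identityʳ-unique (α • 0V) (α • 0V)
    (trans (sym (•-distrib-V α 0V 0V)) (cong (α •_) (V-structure.identityˡ 0V)))

  •-negˡ : ∀ α v → (0K -K α) • v ≡ 0V -V α • v
  •-negˡ α v = V-group.inverseʳ-unique (α • v) ((0K -K α) • v)
    (trans (sym (•-distrib-K α (0K -K α) v)) (trans (cong (_• v) (K.-‿inverseʳ α)) (•-zeroˡ v)))

  neg-+V-comm : ∀ v w → (0V -V v) +V (0V -V w) ≡ 0V -V (v +V w)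
  neg-+V-comm = V-abelian.⁻¹-∙-comm

  neg-0V : 0V -V 0V ≡ 0V
  neg-0V = V-group.ε⁻¹≈ε

  +V-identityˡ : ∀ v → 0V +V v ≡ v
  +V-identityˡ = V-structure.identityˡ

  +V-identityʳ : ∀ v → v +V 0V ≡ v
  +V-identityʳ = V-structure.identityʳ

  +V-assoc : ∀ u v w → (u +V v) +V w ≡ u +V (v +V w)
  +V-assoc = V-structure.assoc

  br-zeroˡ : ∀ w → ⟦ 0V , w ⟧ ≡ 0V
  br-zeroˡ w = V-group.identityʳ-unique ⟦ 0V , w ⟧ ⟦ 0V , w ⟧
    (trans (sym (br-add-l 0V 0V w)) (cong (λ z → ⟦ z , w ⟧) (V-structure.identityˡ 0V)))

  br-zeroʳ : ∀ w → ⟦ w , 0V ⟧ ≡ 0V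
  br-zeroʳ w = V-group.identityʳ-unique ⟦ w , 0V ⟧ ⟦ w , 0V ⟧
    (trans (sym (br-add-r w 0V 0V)) (cong (λ z → ⟦ w , z ⟧) (V-structure.identityˡ 0V)))

module NormalForm (m k : ℕ) where

  infixl 6 _t+K_ _t-K_
  infixl 7 _t×K_

  data NfK : Set where
    fvar : Fin m → NfK
    t0K t1K : NfK
    _t+K_ _t-K_ _t×K_ : NfK → NfK → NfK
    π : (n : ℕ) → Fin n → Vec (List (NfK × LieMon k)) n → List (NfK × LieMon k) → NfK

  -- (α₁ , μ₁) ∷ … ∷ (αₙ , μₙ) ∷ [] stands for α₁ · μ₁ + … + αₙ · μₙ.
  NfV : Set
  NfV = List (NfK × LieMon k)

  neg : NfV → NfV
  neg = map (map₁ (t0K t-K_))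

  scale : NfK → NfV → NfV
  scale α = map (map₁ (α t×K_))

  bracketTerms : NfK × LieMon k → NfK × LieMon k → NfK × LieMon k
  bracketTerms (α , μ) (β , μ′) = α t×K β , br μ μ′

  bracket : NfV → NfV → NfV
  bracket = cartesianProductWith bracketTerms

  normK : Term Full m k κ → NfK
  normV : Term Full m k ν → NfV
  normVs : {n : ℕ} → Vec (Term Full m k ν) n → Vec NfV n
  normK (fvar i) = fvar i
  normK t0K = t0K
  normK t1K = t1K
  normK (t t+K u) = normK t t+K normK u
  normK (t t-K u) = normK t t-K normK u
  normK (t t×K u) = normK t t×K normK u
  normK (π n i ts w) = π n i (normVs ts) (normV w)
  normV (vvar j) = [ t1K , var j ]
  normV t0V = []
  normV (t t+V u) = normV t ++ normV u
  normV (t t-V u) = normV t ++ neg (normV u)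
  normV (brk _ t u) = bracket (normV t) (normV u)
  normV (t t· u) = scale (normK t) (normV u)
  normVs [] = []
  normVs (t ∷ ts) = normV t ∷ normVs ts

  ⌊_⌋M : LieMon k → Term Full m k ν
  ⌊ var j ⌋M = vvar j
  ⌊ br μ μ′ ⌋M = brk tt ⌊ μ ⌋M ⌊ μ′ ⌋M

  ⌊_⌋K : NfK → Term Full m k κ
  ⌊_⌋V : NfV → Term Full m k ν
  ⌊_⌋Vs : {n : ℕ} → Vec NfV n → Vec (Term Full m k ν) n
  ⌊ fvar i ⌋K = fvar i
  ⌊ t0K ⌋K = t0K
  ⌊ t1K ⌋K = t1K
  ⌊ α t+K β ⌋K = ⌊ α ⌋K t+K ⌊ β ⌋K
  ⌊ α t-K β ⌋K = ⌊ α ⌋K t-K ⌊ β ⌋K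
  ⌊ α t×K β ⌋K = ⌊ α ⌋K t×K ⌊ β ⌋K
  ⌊ π n i us w ⌋K = π n i ⌊ us ⌋Vs ⌊ w ⌋V
  ⌊ [] ⌋V = t0V
  ⌊ (α , μ) ∷ u ⌋V = (⌊ α ⌋K t· ⌊ μ ⌋M) t+V ⌊ u ⌋V
  ⌊ [] ⌋Vs = []
  ⌊ u ∷ us ⌋Vs = ⌊ u ⌋V ∷ ⌊ us ⌋Vs

  monomialsK : NfK → List (LieMon k)
  monomialsV : NfV → List (LieMon k)
  monomialsVs : {n : ℕ} → Vec NfV n → List (LieMon k)
  monomialsK (fvar i) = []
  monomialsK t0K = []
  monomialsK t1K = []
  monomialsK (α t+K β) = monomialsK α ++ monomialsK β
  monomialsK (α t-K β) = monomialsK α ++ monomialsK β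
  monomialsK (α t×K β) = monomialsK α ++ monomialsK β
  monomialsK (π n i us w) = monomialsVs us ++ monomialsV w
  monomialsV [] = []
  monomialsV ((α , μ) ∷ u) = monomialsK α ++ μ ∷ monomialsV u
  monomialsVs [] = []
  monomialsVs (u ∷ us) = monomialsV u ++ monomialsVs us

  module _ (L : List (LieMon k)) where
    abstractK : (α : NfK) → monomialsK α ⊆ L → Term Minus m (length L) κ
    abstractV : (u : NfV) → monomialsV u ⊆ L → Term Minus m (length L) ν
    abstractVs : {n : ℕ} (us : Vec NfV n) → monomialsVs us ⊆ L → Vec (Term Minus m (length L) ν) n
    abstractK (fvar i) _ = fvar i
    abstractK t0K _ = t0K
    abstractK t1K _ = t1K
    abstractK (α t+K β) ⊆L = abstractK α (⊆-++⁻ˡ _ ⊆L) t+K abstractK β (⊆-++⁻ʳ (monomialsK α) ⊆L)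
    abstractK (α t-K β) ⊆L = abstractK α (⊆-++⁻ˡ _ ⊆L) t-K abstractK β (⊆-++⁻ʳ (monomialsK α) ⊆L)
    abstractK (α t×K β) ⊆L = abstractK α (⊆-++⁻ˡ _ ⊆L) t×K abstractK β (⊆-++⁻ʳ (monomialsK α) ⊆L)
    abstractK (π n i us w) ⊆L = π n i (abstractVs us (⊆-++⁻ˡ _ ⊆L)) (abstractV w (⊆-++⁻ʳ (monomialsVs us) ⊆L))
    abstractV [] _ = t0V
    abstractV ((α , μ) ∷ u) ⊆L =
      (abstractK α (⊆-++⁻ˡ _ ⊆L) t· vvar (index (μ∷u⊆L (here refl)))) t+V abstractV u (μ∷u⊆L ∘ there)
      where
      μ∷u⊆L : μ ∷ monomialsV u ⊆ L
      μ∷u⊆L = ⊆-++⁻ʳ (monomialsK α) ⊆L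
    abstractVs [] _ = []
    abstractVs (u ∷ us) ⊆L = abstractV u (⊆-++⁻ˡ _ ⊆L) ∷ abstractVs us (⊆-++⁻ʳ (monomialsV u) ⊆L)

  module Semantics {c : ℕ} {a : Level} (M : Model c a) (x : Fin m → Model.K M) (y : Fin k → Model.V M) where
    open Model M
    open Sem M
    open ModelProperties M

    evalK : NfK → K
    evalV : NfV → V
    evalVs : {n : ℕ} → Vec NfV n → Vec V n
    evalK (fvar i) = x i
    evalK t0K = 0K
    evalK t1K = 1K
    evalK (α t+K β) = evalK α +K evalK β
    evalK (α t-K β) = evalK α -K evalK β
    evalK (α t×K β) = evalK α *K evalK β
    evalK (π n i us w) = πf n i (evalVs us) (evalV w)
    evalV [] = 0V
    evalV ((α , μ) ∷ u) = evalK α • evalMon μ y +V evalV u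
    evalVs [] = []
    evalVs (u ∷ us) = evalV u ∷ evalVs us

    evalV-++ : ∀ u v → evalV (u ++ v) ≡ evalV u +V evalV v
    evalV-++ [] v = sym (+V-identityˡ _)
    evalV-++ ((α , μ) ∷ u) v = trans (cong (evalK α • evalMon μ y +V_) (evalV-++ u v)) (sym (+V-assoc _ _ _))

    evalV-neg : ∀ u → evalV (neg u) ≡ 0V -V evalV u
    evalV-neg [] = sym neg-0V
    evalV-neg ((α , μ) ∷ u) = trans (cong₂ _+V_ (•-negˡ (evalK α) _) (evalV-neg u)) (neg-+V-comm _ _)

    evalV-scale : ∀ β u → evalV (scale β u) ≡ evalK β • evalV u
    evalV-scale β [] = sym (•-zeroʳ _)
    evalV-scale β ((α , μ) ∷ u) =
      trans (cong₂ _+V_ (•-assoc _ _ _) (evalV-scale β u)) (sym (•-distrib-V _ _ _))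

    evalV-bracketTerms : ∀ α μ v → evalV (map (bracketTerms (α , μ)) v) ≡ evalK α • ⟦ evalMon μ y , evalV v ⟧
    evalV-bracketTerms α μ [] = sym (trans (cong (evalK α •_) (br-zeroʳ _)) (•-zeroʳ _))
    evalV-bracketTerms α μ ((β , μ′) ∷ v) = begin
      (evalK α *K evalK β) • ⟦ evalMon μ y , evalMon μ′ y ⟧ +V evalV (map (bracketTerms (α , μ)) v)
        ≡⟨ cong₂ _+V_ (•-assoc _ _ _) (evalV-bracketTerms α μ v) ⟩
      evalK α • evalK β • ⟦ evalMon μ y , evalMon μ′ y ⟧ +V evalK α • ⟦ evalMon μ y , evalV v ⟧
        ≡⟨ sym (•-distrib-V _ _ _) ⟩
      evalK α • (evalK β • ⟦ evalMon μ y , evalMon μ′ y ⟧ +V ⟦ evalMon μ y , evalV v ⟧)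
        ≡⟨ cong (λ w → evalK α • (w +V ⟦ evalMon μ y , evalV v ⟧)) (sym (br-smul-r _ _ _)) ⟩
      evalK α • (⟦ evalMon μ y , evalK β • evalMon μ′ y ⟧ +V ⟦ evalMon μ y , evalV v ⟧)
        ≡⟨ cong (evalK α •_) (sym (br-add-r _ _ _)) ⟩
      evalK α • ⟦ evalMon μ y , evalK β • evalMon μ′ y +V evalV v ⟧ ∎
      where open ≡-Reasoning

    evalV-bracket : ∀ u v → evalV (bracket u v) ≡ ⟦ evalV u , evalV v ⟧
    evalV-bracket [] v = sym (br-zeroˡ _)
    evalV-bracket ((α , μ) ∷ u) v = begin
      evalV (map (bracketTerms (α , μ)) v ++ bracket u v)
        ≡⟨ evalV-++ (map (bracketTerms (α , μ)) v) (bracket u v) ⟩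
      evalV (map (bracketTerms (α , μ)) v) +V evalV (bracket u v)
        ≡⟨ cong₂ _+V_ (evalV-bracketTerms α μ v) (evalV-bracket u v) ⟩
      evalK α • ⟦ evalMon μ y , evalV v ⟧ +V ⟦ evalV u , evalV v ⟧
        ≡⟨ cong (_+V ⟦ evalV u , evalV v ⟧) (sym (br-smul-l _ _ _)) ⟩
      ⟦ evalK α • evalMon μ y , evalV v ⟧ +V ⟦ evalV u , evalV v ⟧
        ≡⟨ sym (br-add-l _ _ _) ⟩
      ⟦ evalK α • evalMon μ y +V evalV u , evalV v ⟧ ∎
      where open ≡-Reasoning

    normK-sound : ∀ t → evalK (normK t) ≡ eval t x y
    normV-sound : ∀ t → evalV (normV t) ≡ eval t x y
    normVs-sound : {n : ℕ} (ts : Vec (Term Full m k ν) n) → evalVs (normVs ts) ≡ evalVec ts x y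
    normK-sound (fvar i) = refl
    normK-sound t0K = refl
    normK-sound t1K = refl
    normK-sound (t t+K u) = cong₂ _+K_ (normK-sound t) (normK-sound u)
    normK-sound (t t-K u) = cong₂ _-K_ (normK-sound t) (normK-sound u)
    normK-sound (t t×K u) = cong₂ _*K_ (normK-sound t) (normK-sound u)
    normK-sound (π n i ts w) = cong₂ (πf n i) (normVs-sound ts) (normV-sound w)
    normV-sound (vvar j) = trans (+V-identityʳ _) (•-one _)
    normV-sound t0V = refl
    normV-sound (t t+V u) = trans (evalV-++ (normV t) (normV u)) (cong₂ _+V_ (normV-sound t) (normV-sound u))
    normV-sound (t t-V u) = begin
      evalV (normV t ++ neg (normV u))          ≡⟨ evalV-++ (normV t) (neg (normV u)) ⟩
      evalV (normV t) +V evalV (neg (normV u))  ≡⟨ cong₂ _+V_ (normV-sound t) (evalV-neg (normV u)) ⟩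
      eval t x y +V (0V -V evalV (normV u))     ≡⟨ cong (λ w → eval t x y +V (0V -V w)) (normV-sound u) ⟩
      eval t x y +V (0V -V eval u x y)          ≡⟨ sym (V-minus _ _) ⟩
      eval t x y -V eval u x y                  ∎
      where open ≡-Reasoning
    normV-sound (brk _ t u) =
      trans (evalV-bracket (normV t) (normV u)) (cong₂ ⟦_,_⟧ (normV-sound t) (normV-sound u))
    normV-sound (t t· u) =
      trans (evalV-scale (normK t) (normV u)) (cong₂ _•_ (normK-sound t) (normV-sound u))
    normVs-sound [] = refl
    normVs-sound (t ∷ ts) = cong₂ _∷_ (normV-sound t) (normVs-sound ts)

    eval-⌊⌋M : ∀ μ → eval ⌊ μ ⌋M x y ≡ evalMon μ y
    eval-⌊⌋M (var j) = refl
    eval-⌊⌋M (br μ μ′) = cong₂ ⟦_,_⟧ (eval-⌊⌋M μ) (eval-⌊⌋M μ′)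

    eval-⌊⌋K : ∀ α → eval ⌊ α ⌋K x y ≡ evalK α
    eval-⌊⌋V : ∀ u → eval ⌊ u ⌋V x y ≡ evalV u
    eval-⌊⌋Vs : {n : ℕ} (us : Vec NfV n) → evalVec ⌊ us ⌋Vs x y ≡ evalVs us
    eval-⌊⌋K (fvar i) = refl
    eval-⌊⌋K t0K = refl
    eval-⌊⌋K t1K = refl
    eval-⌊⌋K (α t+K β) = cong₂ _+K_ (eval-⌊⌋K α) (eval-⌊⌋K β)
    eval-⌊⌋K (α t-K β) = cong₂ _-K_ (eval-⌊⌋K α) (eval-⌊⌋K β)
    eval-⌊⌋K (α t×K β) = cong₂ _*K_ (eval-⌊⌋K α) (eval-⌊⌋K β)
    eval-⌊⌋K (π n i us w) = cong₂ (πf n i) (eval-⌊⌋Vs us) (eval-⌊⌋V w)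
    eval-⌊⌋V [] = refl
    eval-⌊⌋V ((α , μ) ∷ u) = cong₂ _+V_ (cong₂ _•_ (eval-⌊⌋K α) (eval-⌊⌋M μ)) (eval-⌊⌋V u)
    eval-⌊⌋Vs [] = refl
    eval-⌊⌋Vs (u ∷ us) = cong₂ _∷_ (eval-⌊⌋V u) (eval-⌊⌋Vs us)

    evalV-as-vsum : ∀ u → evalV u ≡ vsum (λ i → eval ⌊ proj₁ (lookup u i) ⌋K x y • evalMon (proj₂ (lookup u i)) y)
    evalV-as-vsum [] = refl
    evalV-as-vsum ((α , μ) ∷ u) = cong₂ _+V_ (cong (_• evalMon μ y) (sym (eval-⌊⌋K α))) (evalV-as-vsum u)

    module _ (L : List (LieMon k)) where
      private
        yL : Fin (length L) → V
        yL j = evalMon (lookup L j) y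

      eval-abstractK : ∀ α (⊆L : monomialsK α ⊆ L) → eval (abstractK L α ⊆L) x yL ≡ evalK α
      eval-abstractV : ∀ u (⊆L : monomialsV u ⊆ L) → eval (abstractV L u ⊆L) x yL ≡ evalV u
      eval-abstractVs : {n : ℕ} (us : Vec NfV n) (⊆L : monomialsVs us ⊆ L) →
                        evalVec (abstractVs L us ⊆L) x yL ≡ evalVs us
      eval-abstractK (fvar i) _ = refl
      eval-abstractK t0K _ = refl
      eval-abstractK t1K _ = refl
      eval-abstractK (α t+K β) _ = cong₂ _+K_ (eval-abstractK α _) (eval-abstractK β _)
      eval-abstractK (α t-K β) _ = cong₂ _-K_ (eval-abstractK α _) (eval-abstractK β _)
      eval-abstractK (α t×K β) _ = cong₂ _*K_ (eval-abstractK α _) (eval-abstractK β _)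
      eval-abstractK (π n i us w) _ = cong₂ (πf n i) (eval-abstractVs us _) (eval-abstractV w _)
      eval-abstractV [] _ = refl
      eval-abstractV ((α , μ) ∷ u) ⊆L =
        cong₂ _+V_ (cong₂ _•_ (eval-abstractK α _) (cong (λ μ′ → evalMon μ′ y) (sym (lookup-index μ∈L))))
                   (eval-abstractV u _)
        where
        μ∈L : μ ∈ L
        μ∈L = ⊆-++⁻ʳ (monomialsK α) ⊆L (here refl)
      eval-abstractVs [] _ = refl
      eval-abstractVs (u ∷ us) _ = cong₂ _∷_ (eval-abstractV u _) (eval-abstractVs us _)

vector-term-linear-form : (c : ℕ) (a : Level) {m k : ℕ} (t : Term Full m k ν) →
  Σ ℕ λ n → Σ (Fin n → Term Full m k κ) λ ts → Σ (Fin n → LieMon k) λ ms →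
    (M : Model c a) (x : Fin m → Model.K M) (y : Fin k → Model.V M) →
    Sem.eval M t x y ≡
      Sem.vsum M (λ i → Model._•_ M (Sem.eval M (ts i) x y) (Sem.evalMon M (ms i) y))
vector-term-linear-form c a {m} {k} t =
  length (normV t) , (λ i → ⌊ proj₁ (lookup (normV t) i) ⌋K) , (λ i → proj₂ (lookup (normV t) i)) ,
  λ M x y → let open Semantics M x y in trans (sym (normV-sound t)) (evalV-as-vsum (normV t))
  where open NormalForm m k

field-term-bracket-free : (c : ℕ) (a : Level) {m k : ℕ} (t : Term Full m k κ) →
  Σ ℕ λ r → Σ (Term Minus m r κ) λ s → Σ (Fin r → LieMon k) λ ms →
    (M : Model c a) (x : Fin m → Model.K M) (y : Fin k → Model.V M) →
    Sem.eval M t x y ≡ Sem.eval M s x (λ j → Sem.evalMon M (ms j) y)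
field-term-bracket-free c a {m} {k} t =
  length L , abstractK L (normK t) ⊆-refl , lookup L ,
  λ M x y → let open Semantics M x y in trans (sym (normK-sound t)) (sym (eval-abstractK L (normK t) _))
  where
  open NormalForm m k
  L : List (LieMon k)
  L = monomialsK (normK t)

lemma4p3 : (c : ℕ) (a : Level) (m k : ℕ) →
    ((t : Term Full m k ν) →
      Σ ℕ λ n → Σ (Fin n → Term Full m k κ) λ ts → Σ (Fin n → LieMon k) λ ms →
        (M : Model c a) (x : Fin m → Model.K M) (y : Fin k → Model.V M) →
        Sem.eval M t x y ≡
          Sem.vsum M (λ i → Model._•_ M (Sem.eval M (ts i) x y) (Sem.evalMon M (ms i) y)))
    ×
    ((t : Term Full m k κ) →
      Σ ℕ λ r → Σ (Term Minus m r κ) λ s → Σ (Fin r → LieMon k) λ ms →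
        (M : Model c a) (x : Fin m → Model.K M) (y : Fin k → Model.V M) →
        Sem.eval M t x y ≡ Sem.eval M s x (λ j → Sem.evalMon M (ms j) y))
lemma4p3 c a m k = vector-term-linear-form c a , field-term-bracket-free c a
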